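{- Let $\varphi,\psi$ be size substitutions for the successor algebra. Then $\varphi\sqsubseteq\psi$ if and only if there is a map $\rho:\mathcal V\to\mathcal V\cup\mathcal C\cup\{\infty\}$ (viewed as a size substitution) such that $\alpha\varphi\rho\preceq_\infty\alpha\psi$ for every $\alpha\in\mathcal V$.
   Context: Let $\mathcal V$ be a set of size variables and $\mathcal C$ an infinite set of size constants, disjoint from $\mathcal V$. The successor size algebra $\mathcal A$ is the set of first-order terms built from $\mathcal V$, the constants of $\mathcal C$ and a unary symbol $\mathsf s$. The relation $\prec$ is the smallest strict ordering on $\mathcal A$ with $a\prec\mathsf s\,a$ for all $a$, and $\preceq$ its reflexive closure. Let $\bar{\mathcal A}=\mathcal A\cup\{\infty\}$ with $\infty\notin\mathcal A$, and let $a\preceq_\infty b$ iff $a\preceq b$ or $b=\infty$. A size substitution is a map $\varphi:\mathcal V\to\bar{\mathcal A}$ with finite domain $\{\alpha\mid \alpha\varphi\neq\alpha\}$; it is applied to $a\in\bar{\mathcal A}$ by setting $a\varphi=\infty$ if $a=\infty$ or $a$ contains a variable $\alpha$ with $\alpha\varphi=\infty$, and by the usual replacement otherwise. Composition is $\alpha(\varphi\theta)=(\alpha\varphi)\theta$. We write $\varphi\sqsubseteq\psi$ ($\varphi$ is more general than $\psi$) if there is a size substitution $\theta$ such that $\alpha\varphi\theta\preceq_\infty\alpha\psi$ for all $\alpha\in\mathcal V$. -}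

module Defs where

open import Data.Nat using (ℕ)
open import Data.List using (List)
open import Data.List.Membership.Propositional using (_∈_)
open import Data.Product using (Σ; _×_; ∃)
open import Data.Sum using (_⊎_)
open import Function.Definitions using (Injective)
open import Relation.Binary.PropositionalEquality using (_≡_; _≢_)

Infinite : Set → Set
Infinite C = Σ (ℕ → C) λ f → Injective _≡_ _≡_ f

module _ {V C : Set} where

  data Size : Set where
    var : V → Size
    con : C → Size
    s   : Size → Size

  data _≺_ : Size → Size → Set where
    ≺-base  : ∀ {a} → a ≺ s a
    ≺-trans : ∀ {a b c} → a ≺ b → b ≺ c → a ≺ c

  _⪯_ : Size → Size → Set
  a ⪯ b = a ≡ b ⊎ a ≺ b

  data SizeInf : Set where
    fin : Size → SizeInf
    ∞   : SizeInf

  data _⪯∞_ : SizeInf → SizeInf → Set where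
    fin⪯ : ∀ {a b} → a ⪯ b → fin a ⪯∞ fin b
    ⪯∞′  : ∀ {a} → a ⪯∞ ∞

  sucInf : SizeInf → SizeInf
  sucInf (fin a) = fin (s a)
  sucInf ∞       = ∞

  record SizeSubst : Set where
    field
      map    : V → SizeInf
      dom    : List V
      finDom : ∀ α → map α ≢ fin (var α) → α ∈ dom
  open SizeSubst public

  appT : SizeSubst → Size → SizeInf
  appT φ (var α) = map φ α
  appT φ (con c) = fin (con c)
  appT φ (s a)   = sucInf (appT φ a)

  _·_ : SizeInf → SizeSubst → SizeInf
  fin a · φ = appT φ a
  ∞     · φ = ∞

  _∘ₛ_ : (V → SizeInf) → SizeSubst → V → SizeInf
  (φ ∘ₛ θ) α = φ α · θ

  _⊑_ : SizeSubst → SizeSubst → Set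
  φ ⊑ ψ = Σ SizeSubst λ θ → ∀ α → (map φ α · θ) ⪯∞ map ψ α

  data IsAtomOrInf : SizeInf → Set where
    atom-var : ∀ β → IsAtomOrInf (fin (var β))
    atom-con : ∀ c → IsAtomOrInf (fin (con c))
    atom-∞   : IsAtomOrInf ∞

module Submission where

-- A substitution θ witnessing φ ⊑ ψ can always be replaced by one whose
-- values are atoms (a variable, a constant, or ∞): keep ∞, and map every
-- finite value sᵏ a (a ∈ V ∪ C) to its root a.
--
-- Applied to the root
--     substitution of θ this gives αφθ^root ⪯∞ αφθ ⪯∞ αψ.
-- The converse direction of the theorem is immediate, since an atomic ρ is
-- itself a witness of φ ⊑ ψ.

open import Defs
open import Data.Product using (Σ; _×_; _,_)
open import Data.Sum using (inj₁; inj₂)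
open import Function.Bundles using (_⇔_; mk⇔)
open import Relation.Binary.PropositionalEquality using (_≡_; refl; cong)

module _ {V C : Set} where

  s-mono-≺ : {a b : Size {V} {C}} → a ≺ b → s a ≺ s b
  s-mono-≺ ≺-base        = ≺-base
  s-mono-≺ (≺-trans p q) = ≺-trans (s-mono-≺ p) (s-mono-≺ q)

  sucInf-mono : {x y : SizeInf {V} {C}} → x ⪯∞ y → sucInf x ⪯∞ sucInf y
  sucInf-mono (fin⪯ (inj₁ a≡b)) = fin⪯ (inj₁ (cong s a≡b))
  sucInf-mono (fin⪯ (inj₂ a≺b)) = fin⪯ (inj₂ (s-mono-≺ a≺b))
  sucInf-mono ⪯∞′               = ⪯∞′

  ⪯-trans : {a b c : Size {V} {C}} → a ⪯ b → b ⪯ c → a ⪯ c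
  ⪯-trans (inj₁ refl) b⪯c         = b⪯c
  ⪯-trans (inj₂ a≺b)  (inj₁ refl) = inj₂ a≺b
  ⪯-trans (inj₂ a≺b)  (inj₂ b≺c)  = inj₂ (≺-trans a≺b b≺c)

  ⪯∞-trans : {x y z : SizeInf {V} {C}} → x ⪯∞ y → y ⪯∞ z → x ⪯∞ z
  ⪯∞-trans (fin⪯ a⪯b) (fin⪯ b⪯c) = fin⪯ (⪯-trans a⪯b b⪯c)
  ⪯∞-trans _          ⪯∞′         = ⪯∞′

  root : Size {V} {C} → Size {V} {C}
  root (var β) = var β
  root (con c) = con c
  root (s a)   = root a

  root-⪯ : (a : Size {V} {C}) → root a ⪯ a
  root-⪯ (var β) = inj₁ refl
  root-⪯ (con c) = inj₁ refl
  root-⪯ (s a)   = ⪯-trans (root-⪯ a) (inj₂ ≺-base)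

  rootInf : SizeInf {V} {C} → SizeInf {V} {C}
  rootInf (fin a) = fin (root a)
  rootInf ∞       = ∞

  rootInf-⪯∞ : (x : SizeInf {V} {C}) → rootInf x ⪯∞ x
  rootInf-⪯∞ (fin a) = fin⪯ (root-⪯ a)
  rootInf-⪯∞ ∞       = ⪯∞′

  rootInf-atomic : (x : SizeInf {V} {C}) → IsAtomOrInf (rootInf x)
  rootInf-atomic (fin a) = root-atomic a
    where
    root-atomic : (a : Size {V} {C}) → IsAtomOrInf (fin (root a))
    root-atomic (var β) = atom-var β
    root-atomic (con c) = atom-con c
    root-atomic (s a)   = root-atomic a
  rootInf-atomic ∞ = atom-∞

  -- θ^root : β ↦ root of βθ.  It fixes every variable that θ fixes, so its
  -- domain is contained in that of θ.
  rootSubst : SizeSubst {V} {C} → SizeSubst {V} {C}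
  rootSubst θ = record
    { map    = λ β → rootInf (map θ β)
    ; dom    = dom θ
    ; finDom = λ β moved → finDom θ β (λ fixed → moved (cong rootInf fixed))
    }

  ·-mono-subst : (θ′ θ : SizeSubst {V} {C}) →
                 (∀ β → map θ′ β ⪯∞ map θ β) →
                 (x : SizeInf {V} {C}) → (x · θ′) ⪯∞ (x · θ)
  ·-mono-subst θ′ θ θ′⪯θ (fin a) = appT-mono a
    where
    appT-mono : (a : Size {V} {C}) → appT θ′ a ⪯∞ appT θ a
    appT-mono (var β) = θ′⪯θ β
    appT-mono (con c) = fin⪯ (inj₁ refl)
    appT-mono (s a)   = sucInf-mono (appT-mono a)
  ·-mono-subst θ′ θ θ′⪯θ ∞ = ⪯∞′

  AtomicallyMoreGeneral : SizeSubst {V} {C} → SizeSubst {V} {C} → Set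
  AtomicallyMoreGeneral φ ψ = Σ (SizeSubst {V} {C}) (λ ρ →
    (∀ α → IsAtomOrInf (map ρ α)) × (∀ α → (map φ α · ρ) ⪯∞ map ψ α))

  atomic-witness : (φ ψ θ : SizeSubst {V} {C}) →
                   (∀ α → (map φ α · θ) ⪯∞ map ψ α) →
                   ∀ α → (map φ α · rootSubst θ) ⪯∞ map ψ α
  atomic-witness φ ψ θ φθ⪯ψ α =
    ⪯∞-trans (·-mono-subst (rootSubst θ) θ (λ β → rootInf-⪯∞ (map θ β)) (map φ α))
             (φθ⪯ψ α)

mainTheorem2 : {V C : Set} → Infinite C → (φ ψ : SizeSubst {V} {C}) →
    (φ ⊑ ψ) ⇔ Σ (SizeSubst {V} {C}) (λ ρ →
    (∀ α → IsAtomOrInf (map ρ α)) × (∀ α → (map φ α · ρ) ⪯∞ map ψ α))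
mainTheorem2 _ φ ψ = mk⇔ toAtomic fromAtomic
  where
  toAtomic : φ ⊑ ψ → AtomicallyMoreGeneral φ ψ
  toAtomic (θ , φθ⪯ψ) =
    rootSubst θ , (λ β → rootInf-atomic (map θ β)) , atomic-witness φ ψ θ φθ⪯ψ
  fromAtomic : AtomicallyMoreGeneral φ ψ → φ ⊑ ψ
  fromAtomic (ρ , _ , φρ⪯ψ) = ρ , φρ⪯ψ
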